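{- Let $G=(V,E)$ be a graph with $\mathrm{diam}(G)\ge 2\,\mathrm{rad}(G)-1$, and let $x,y\in V$ with $d(x,y)=\mathrm{diam}(G)$. Then $\{x,y\}$ is a radius certificate of $G$ of minimum size. Furthermore, $\mathrm{rad}(G)=\lfloor\frac{d(x,y)+1}{2}\rfloor$.
   Context: $G$ is finite, connected, undirected, unweighted; $d$ is shortest-path distance, $e(u)=\max_v d(u,v)$, $\mathrm{rad}(G)=\min_u e(u)$, $\mathrm{diam}(G)=\max_u e(u)$. A set $L\subseteq V$ is a radius certificate if for every $u\in V$ there is $z\in L$ with $d(u,z)\ge\mathrm{rad}(G)$. -}

module Defs where

open import Data.Nat using (ℕ; zero; suc; _≤_; _⊔_; _⊓_)
open import Data.Fin using (Fin)
open import Data.Fin.Subset using (Subset; _∈_)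
open import Data.List using (List; []; _∷_; map; foldr; allFin)
open import Data.Product using (Σ; ∃; _×_)
open import Relation.Nullary using (¬_)
open import Relation.Binary.PropositionalEquality using (_≡_)

record Graph (n : ℕ) : Set₁ where
  field
    Adj    : Fin n → Fin n → Set
    sym    : ∀ {u v} → Adj u v → Adj v u
    irrefl : ∀ {u} → ¬ Adj u u

data Walk {n : ℕ} (G : Graph n) : Fin n → Fin n → ℕ → Set where
  here : ∀ {u} → Walk G u u zero
  step : ∀ {u w v k} → Graph.Adj G u w → Walk G w v k → Walk G u v (suc k)

Connected : ∀ {n} → Graph n → Set
Connected G = ∀ u v → ∃ λ k → Walk G u v k

IsShortestPathDistance : ∀ {n} → Graph n → (Fin n → Fin n → ℕ) → Set
IsShortestPathDistance G d =
  ∀ u v → Walk G u v (d u v) × (∀ k → Walk G u v k → d u v ≤ k)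

-- maximum / minimum of a list of naturals (minimum of [] is 0; only used
-- on nonempty vertex sets)
maxL : List ℕ → ℕ
maxL = foldr _⊔_ 0

minL : List ℕ → ℕ
minL []       = 0
minL (x ∷ xs) = foldr _⊓_ x xs

module _ {n : ℕ} (d : Fin n → Fin n → ℕ) where

  ecc : Fin n → ℕ
  ecc u = maxL (map (d u) (allFin n))

  rad : ℕ
  rad = minL (map ecc (allFin n))

  diam : ℕ
  diam = maxL (map ecc (allFin n))

  RadiusCertificate : Subset n → Set
  RadiusCertificate L = ∀ u → Σ (Fin n) λ z → z ∈ L × rad ≤ d u z

-- The distance d satisfies d(x, y) ≤ d(x, c) + d(c, y) ≤ 2 rad(G) for a centre c, so
-- 2 rad - 1 ≤ d(x, y) ≤ 2 rad pins rad down to ⌊(d(x, y) + 1) / 2⌋. For any vertex u,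
-- d(u, x) + d(u, y) ≥ d(x, y) ≥ 2 rad - 1, so one of x, y is at distance ≥ rad from u.
-- No certificate is smaller: it is nonempty, and when x ≠ y we have rad ≥ 1, so the vertex
-- z certifying some u needs a second vertex z' ≠ z certifying z itself.
module Submission where

open import Defs
open import Data.Nat using (ℕ; suc; _≤_; _<_; _+_; _*_; _/_; z≤n; s≤s)
open import Data.Nat.Properties
open import Data.Nat.DivMod using (m*n/n≡m; +-distrib-/-∣ˡ)
open import Data.Nat.Divisibility using (m∣m*n)
open import Data.Bool using (true; false)
open import Data.Vec using ([]; _∷_)
open import Data.Fin using (Fin)
open import Data.Fin.Properties using () renaming (_≟_ to _≟ᶠ_)
open import Data.Fin.Subset using (Subset; ⁅_⁆; _∪_; ∣_∣; _∈_; _⊆_)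
open import Data.Fin.Subset.Properties
  using (x∈⁅x⁆; x∈⁅y⁆⇒x≡y; x≢y⇒x∉⁅y⁆; x∈p∪q⁺; ∣⁅x⁆∣≡1; ∪-idem; p⊆q⇒∣p∣≤∣q∣; p⊂q⇒∣p∣<∣q∣)
open import Data.List using (_∷_)
open import Data.List.Relation.Unary.Any as Any using (Any; here; there)
open import Data.List.Membership.Propositional using () renaming (_∈_ to _∈ˡ_)
open import Data.List.Membership.Propositional.Properties
  using (∈-map⁺; ∈-map⁻; ∈-allFin; foldr-selective)
open import Data.List.Properties using (foldr-preservesᵒ)
open import Data.Product using (∃; _×_; _,_; proj₁; proj₂)
open import Data.Sum using (_⊎_; inj₁; inj₂; [_,_]′)
open import Function using (_∘_)
open import Relation.Nullary using (yes; no)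
open import Relation.Binary.PropositionalEquality
  using (_≡_; _≢_; refl; sym; trans; cong; cong₂; subst; module ≡-Reasoning)

module _ {n : ℕ} {G : Graph n} where
  open Graph G using (Adj)

  _++ʷ_ : ∀ {u v w k m} → Walk G u v k → Walk G v w m → Walk G u w (k + m)
  here     ++ʷ q = q
  step a p ++ʷ q = step a (p ++ʷ q)

  _∷ʳʷ_ : ∀ {u v w k} → Walk G u v k → Adj v w → Walk G u w (suc k)
  here     ∷ʳʷ a = step a here
  step b p ∷ʳʷ a = step b (p ∷ʳʷ a)

  reverseʷ : ∀ {u v k} → Walk G u v k → Walk G v u k
  reverseʷ here       = here
  reverseʷ (step a p) = reverseʷ p ∷ʳʷ Graph.sym G a

  walk-of-length-0⇒≡ : ∀ {u v} → Walk G u v 0 → u ≡ v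
  walk-of-length-0⇒≡ here = refl

≤maxL : ∀ {m xs} → m ∈ˡ xs → m ≤ maxL xs
≤maxL {m} {xs} m∈xs =
  foldr-preservesᵒ {P = m ≤_} (λ a b → [ m≤n⇒m≤n⊔o b , m≤n⇒m≤o⊔n a ]′)
    0 xs (inj₂ (Any.map ≤-reflexive m∈xs))

minL∈ : ∀ {m xs} → m ∈ˡ xs → minL xs ∈ˡ xs
minL∈ {xs = a ∷ xs} _ = [ here , there ]′ (foldr-selective ⊓-sel a xs)

module _ {n : ℕ} (d : Fin n → Fin n → ℕ) where

  d≤ecc : ∀ u v → d u v ≤ ecc d u
  d≤ecc u v = ≤maxL (∈-map⁺ (d u) (∈-allFin v))

  centre : Fin n → ∃ λ c → ecc d c ≡ rad d
  centre u =
    let c , _ , rad≡ecc = ∈-map⁻ (ecc d) (minL∈ (∈-map⁺ (ecc d) (∈-allFin u)))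
    in  c , sym rad≡ecc

x∈p⇒⁅x⁆⊆p : ∀ {n x} {p : Subset n} → x ∈ p → ⁅ x ⁆ ⊆ p
x∈p⇒⁅x⁆⊆p {x = x} x∈p y∈⁅x⁆ = subst (_∈ _) (sym (x∈⁅y⁆⇒x≡y x y∈⁅x⁆)) x∈p

x∈p⇒1≤∣p∣ : ∀ {n x} {p : Subset n} → x ∈ p → 1 ≤ ∣ p ∣
x∈p⇒1≤∣p∣ {x = x} x∈p = subst (_≤ _) (∣⁅x⁆∣≡1 x) (p⊆q⇒∣p∣≤∣q∣ (x∈p⇒⁅x⁆⊆p x∈p))

x∈p⇒y∈p⇒x≢y⇒2≤∣p∣ : ∀ {n x y} {p : Subset n} → x ∈ p → y ∈ p → x ≢ y → 2 ≤ ∣ p ∣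
x∈p⇒y∈p⇒x≢y⇒2≤∣p∣ {x = x} {y} x∈p y∈p x≢y =
  subst (_< _) (∣⁅x⁆∣≡1 x)
    (p⊂q⇒∣p∣<∣q∣ (x∈p⇒⁅x⁆⊆p x∈p , y , y∈p , x≢y⇒x∉⁅y⁆ (x≢y ∘ sym)))

∣p∪q∣≤∣p∣+∣q∣ : ∀ {n} (p q : Subset n) → ∣ p ∪ q ∣ ≤ ∣ p ∣ + ∣ q ∣
∣p∪q∣≤∣p∣+∣q∣ []          []          = z≤n
∣p∪q∣≤∣p∣+∣q∣ (true  ∷ p) (true  ∷ q) =
  s≤s (≤-trans (∣p∪q∣≤∣p∣+∣q∣ p q) (+-monoʳ-≤ ∣ p ∣ (n≤1+n ∣ q ∣)))
∣p∪q∣≤∣p∣+∣q∣ (true  ∷ p) (false ∷ q) = s≤s (∣p∪q∣≤∣p∣+∣q∣ p q)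
∣p∪q∣≤∣p∣+∣q∣ (false ∷ p) (true  ∷ q) =
  ≤-trans (s≤s (∣p∪q∣≤∣p∣+∣q∣ p q)) (≤-reflexive (sym (+-suc ∣ p ∣ ∣ q ∣)))
∣p∪q∣≤∣p∣+∣q∣ (false ∷ p) (false ∷ q) = ∣p∪q∣≤∣p∣+∣q∣ p q

2*r≤m+n+1⇒r≤m⊎r≤n : ∀ {r} m n → 2 * r ≤ m + n + 1 → r ≤ m ⊎ r ≤ n
2*r≤m+n+1⇒r≤m⊎r≤n {r} m n 2r≤m+n+1 with r ≤? m
... | yes r≤m = inj₁ r≤m
... | no  r≰m = inj₂ (+-cancelˡ-≤ r r n (begin
  r + r         ≡⟨ cong (r +_) (+-identityʳ r) ⟨
  2 * r         ≤⟨ 2r≤m+n+1 ⟩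
  m + n + 1     ≡⟨ +-comm (m + n) 1 ⟩
  suc m + n     ≤⟨ +-monoˡ-≤ n (≰⇒> r≰m) ⟩
  r + n         ∎))
  where open ≤-Reasoning

[2*n]/2≡n : ∀ n → 2 * n / 2 ≡ n
[2*n]/2≡n n = trans (cong (_/ 2) (*-comm 2 n)) (m*n/n≡m n 2)

[2*n+1]/2≡n : ∀ n → (2 * n + 1) / 2 ≡ n
[2*n+1]/2≡n n = begin
  (2 * n + 1) / 2    ≡⟨ +-distrib-/-∣ˡ 1 (m∣m*n n) ⟩
  2 * n / 2 + 1 / 2  ≡⟨ +-identityʳ (2 * n / 2) ⟩
  2 * n / 2          ≡⟨ [2*n]/2≡n n ⟩
  n                  ∎
  where open ≡-Reasoning

m≤2*n≤m+1⇒n≡[m+1]/2 : ∀ {m n} → m ≤ 2 * n → 2 * n ≤ m + 1 → n ≡ (m + 1) / 2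
m≤2*n≤m+1⇒n≡[m+1]/2 {m} {n} m≤2n 2n≤m+1 with m≤n⇒m<n∨m≡n m≤2n
... | inj₂ refl = sym ([2*n+1]/2≡n n)
... | inj₁ m<2n = begin
  n              ≡⟨ [2*n]/2≡n n ⟨
  2 * n / 2      ≡⟨ cong (_/ 2) (≤-antisym 2n≤m+1 (subst (_≤ 2 * n) (+-comm 1 m) m<2n)) ⟩
  (m + 1) / 2    ∎
  where open ≡-Reasoning

module ShortestPathDistance {n} {G : Graph n} {d : Fin n → Fin n → ℕ}
                            (isSPD : IsShortestPathDistance G d) where

  geodesic : ∀ u v → Walk G u v (d u v)
  geodesic u v = proj₁ (isSPD u v)

  d≤length : ∀ {u v k} → Walk G u v k → d u v ≤ k
  d≤length {u} {v} {k} = proj₂ (isSPD u v) k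

  d-sym : ∀ u v → d u v ≡ d v u
  d-sym u v =
    ≤-antisym (d≤length (reverseʷ (geodesic v u))) (d≤length (reverseʷ (geodesic u v)))

  d-triangle : ∀ u v w → d u w ≤ d u v + d v w
  d-triangle u v w = d≤length (geodesic u v ++ʷ geodesic v w)

  d-refl : ∀ u → d u u ≡ 0
  d-refl u = n≤0⇒n≡0 (d≤length here)

  d≡0⇒≡ : ∀ {u v} → d u v ≡ 0 → u ≡ v
  d≡0⇒≡ {u} {v} duv≡0 = walk-of-length-0⇒≡ (subst (Walk G u v) duv≡0 (geodesic u v))

  d≤2*rad : ∀ x y → d x y ≤ 2 * rad d
  d≤2*rad x y = begin
    d x y              ≤⟨ d-triangle x c y ⟩
    d x c + d c y      ≡⟨ cong (_+ d c y) (d-sym x c) ⟩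
    d c x + d c y      ≤⟨ +-mono-≤ (d≤ecc d c x) (d≤ecc d c y) ⟩
    ecc d c + ecc d c  ≡⟨ cong₂ _+_ ecc≡rad (trans ecc≡rad (sym (+-identityʳ (rad d)))) ⟩
    2 * rad d          ∎
    where
    open ≤-Reasoning
    c = proj₁ (centre d x)
    ecc≡rad = proj₂ (centre d x)

  x≢y⇒0<rad : ∀ {x y} → x ≢ y → 0 < rad d
  x≢y⇒0<rad {x} {y} x≢y = n≢0⇒n>0 λ rad≡0 →
    x≢y (d≡0⇒≡ (n≤0⇒n≡0 (subst (λ r → d x y ≤ 2 * r) rad≡0 (d≤2*rad x y))))

  pair-isRadiusCertificate : ∀ x y → 2 * rad d ≤ d x y + 1 → RadiusCertificate d (⁅ x ⁆ ∪ ⁅ y ⁆)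
  pair-isRadiusCertificate x y 2r≤dxy+1 u
    with 2*r≤m+n+1⇒r≤m⊎r≤n (d u x) (d u y) (≤-trans 2r≤dxy+1 (+-monoˡ-≤ 1 dxy≤dux+duy))
    where
    dxy≤dux+duy : d x y ≤ d u x + d u y
    dxy≤dux+duy = subst (λ e → d x y ≤ e + d u y) (d-sym x u) (d-triangle x u y)
  ... | inj₁ r≤dux = x , x∈p∪q⁺ (inj₁ (x∈⁅x⁆ x)) , r≤dux
  ... | inj₂ r≤duy = y , x∈p∪q⁺ (inj₂ (x∈⁅x⁆ y)) , r≤duy

  0<rad⇒2≤∣certificate∣ : 0 < rad d → ∀ {L} → RadiusCertificate d L → Fin n → 2 ≤ ∣ L ∣
  0<rad⇒2≤∣certificate∣ 0<rad isCert u =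
    let z , z∈L , _ = isCert u
        z′ , z′∈L , rad≤dzz′ = isCert z
        z≢z′ : z ≢ z′
        z≢z′ = λ z≡z′ →
          <⇒≱ 0<rad (≤-trans rad≤dzz′ (≤-reflexive (trans (cong (d z) (sym z≡z′)) (d-refl z))))
    in  x∈p⇒y∈p⇒x≢y⇒2≤∣p∣ z∈L z′∈L z≢z′

  pair-minimum : ∀ x y {L} → RadiusCertificate d L → ∣ ⁅ x ⁆ ∪ ⁅ y ⁆ ∣ ≤ ∣ L ∣
  pair-minimum x y {L} isCert with x ≟ᶠ y
  ... | yes refl = begin
    ∣ ⁅ x ⁆ ∪ ⁅ x ⁆ ∣  ≡⟨ cong ∣_∣ (∪-idem ⁅ x ⁆) ⟩
    ∣ ⁅ x ⁆ ∣          ≡⟨ ∣⁅x⁆∣≡1 x ⟩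
    1                  ≤⟨ x∈p⇒1≤∣p∣ (proj₁ (proj₂ (isCert x))) ⟩
    ∣ L ∣              ∎
    where open ≤-Reasoning
  ... | no x≢y = begin
    ∣ ⁅ x ⁆ ∪ ⁅ y ⁆ ∣      ≤⟨ ∣p∪q∣≤∣p∣+∣q∣ ⁅ x ⁆ ⁅ y ⁆ ⟩
    ∣ ⁅ x ⁆ ∣ + ∣ ⁅ y ⁆ ∣  ≡⟨ cong₂ _+_ (∣⁅x⁆∣≡1 x) (∣⁅x⁆∣≡1 y) ⟩
    2                      ≤⟨ 0<rad⇒2≤∣certificate∣ (x≢y⇒0<rad x≢y) isCert x ⟩
    ∣ L ∣                  ∎
    where open ≤-Reasoning

proposition10 : ∀ {n} (G : Graph n) → Connected G →
    (d : Fin n → Fin n → ℕ) → IsShortestPathDistance G d →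
    2 * rad d ≤ diam d + 1 →
    (x y : Fin n) → d x y ≡ diam d →
    (RadiusCertificate d (⁅ x ⁆ ∪ ⁅ y ⁆)
      × (∀ (L : Subset n) → RadiusCertificate d L → ∣ ⁅ x ⁆ ∪ ⁅ y ⁆ ∣ ≤ ∣ L ∣))
    × rad d ≡ (d x y + 1) / 2
proposition10 G _ d isSPD 2r≤diam+1 x y dxy≡diam =
  (pair-isRadiusCertificate x y 2r≤dxy+1 , λ _ → pair-minimum x y) ,
  m≤2*n≤m+1⇒n≡[m+1]/2 (d≤2*rad x y) 2r≤dxy+1
  where
  open ShortestPathDistance isSPD
  2r≤dxy+1 : 2 * rad d ≤ d x y + 1
  2r≤dxy+1 = subst (λ D → 2 * rad d ≤ D + 1) (sym dxy≡diam) 2r≤diam+1
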